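{- The following hold. \begin{enumerate} \item $m^{s}(k,q)<m^{s+1}(k,q)$. \item For $k\ge 2$, $m^{s}(k,q)\le m^{s}(k-1,q)+1$. \item For $\alpha<k$, $m^{s}(k,q)\le m^{s}(k-\alpha,q)+\alpha$. In particular, for $k\ge 3$, $m^{s}(k,q)\le m^{s}(3,q)+k-3$. \item If $s=k-1+s_1+s_2$ with integers $s_1,s_2\ge 0$, then $m^s(k,q)\ge m^{s_1}(k,q)+m^{s_2}(k,q)$. \item $m^s(3,q)\ge \frac{s+2}{2}\, m(3,q)$ if $s$ is even, and $m^s(3,q)\ge \frac{s-1}{2}\, m(3,q)+m^1(3,q)$ if $s$ is odd. \end{enumerate}
   Context: A linear $[n,k,d]_q$ code is identified with a projective system: a finite multiset $\mathcal{G}$ of $n$ points (counted with multiplicity) of $\mathrm{PG}(k-1,q)$, not all lying in one hyperplane, with $n-d=\max_H|\mathcal{G}\cap H|$ over hyperplanes $H$ (counted with multiplicity). The Singleton defect is $n-k+1-d$; the code is A$^s$MDS if its Singleton defect is $s$ (MDS if $s=0$). $m^s(k,q)$ denotes the maximum length $n$ of a non-degenerate $[n,k,d]_q$ A$^s$MDS code, and $m(k,q)=m^0(k,q)$. -}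

module Defs where

open import Level using (0ℓ)
open import Data.Nat using (ℕ; zero; suc; _+_; _*_; _∸_; _≤_; _<_)
open import Data.Fin using (Fin)
open import Data.Product using (Σ; ∃; _×_; _,_)
open import Relation.Binary.PropositionalEquality using (_≡_)
open import Relation.Binary.Definitions using (DecidableEquality)
open import Relation.Nullary using (¬_; Dec; yes; no)
open import Algebra.Structures using (IsCommutativeRing)
open import Function.Bundles using (_↔_)

record FiniteField (q : ℕ) : Set₁ where
  field
    Carrier : Set
    _+F_ _*F_ : Carrier → Carrier → Carrier
    -F_ : Carrier → Carrier
    0F 1F : Carrier
    isCommutativeRing : IsCommutativeRing _≡_ _+F_ _*F_ -F_ 0F 1F
    0≢1 : ¬ (0F ≡ 1F)
    inverse : ∀ x → ¬ (x ≡ 0F) → Σ Carrier (λ y → x *F y ≡ 1F)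
    _≟_ : DecidableEquality Carrier
    size : Carrier ↔ Fin q

module _ {q : ℕ} (F : FiniteField q) where
  open FiniteField F

  Vec : ℕ → Set
  Vec k = Fin k → Carrier

  NonZero : {k : ℕ} → Vec k → Set
  NonZero v = Σ _ (λ i → ¬ (v i ≡ 0F))

  dot : {k : ℕ} → Vec k → Vec k → Carrier
  dot {zero} u v = 0F
  dot {suc k} u v = (u Data.Fin.zero *F v Data.Fin.zero) +F dot (λ i → u (Data.Fin.suc i)) (λ i → v (Data.Fin.suc i))

  count : {n : ℕ} → (P : Fin n → Carrier) → ℕ
  count {zero} P = 0
  count {suc n} P with P Data.Fin.zero ≟ 0F
  ... | yes _ = suc (count (λ i → P (Data.Fin.suc i)))
  ... | no _ = count (λ i → P (Data.Fin.suc i))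

  -- A projective system: n points of PG(k-1,q) (nonzero representatives,
  -- repetitions allowed = multiplicities).
  record ProjSystem (n k : ℕ) : Set where
    field
      pt : Fin n → Vec k
      pt-nonzero : ∀ i → NonZero (pt i)

  -- |G ∩ H| for the hyperplane H = { x : u·x = 0 }, u ≠ 0
  meet : {n k : ℕ} → ProjSystem n k → Vec k → ℕ
  meet G u = count (λ i → dot u (ProjSystem.pt G i))

  NonDegenerate : {n k : ℕ} → ProjSystem n k → Set
  NonDegenerate {n} {k} G = ∀ (u : Vec k) → NonZero u → Σ (Fin n) (λ i → ¬ (dot u (ProjSystem.pt G i) ≡ 0F))

  -- n - d = max over hyperplanes H of |G ∩ H|
  MinDist : {n k : ℕ} → ProjSystem n k → ℕ → Set
  MinDist {n} {k} G d =
    (∀ (u : Vec k) → NonZero u → meet G u + d ≤ n) ×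
    Σ (Vec k) (λ u → NonZero u × (meet G u + d ≡ n))

  -- a non-degenerate [n,k,d]_q code with Singleton defect s (n - k + 1 - d = s)
  AsMDS : ℕ → (n k : ℕ) → Set
  AsMDS s n k = Σ (ProjSystem n k) (λ G → NonDegenerate G ×
                  Σ ℕ (λ d → MinDist G d × (n + 1 ≡ k + d + s)))

  IsMaxLen : (s k m : ℕ) → Set
  IsMaxLen s k m = AsMDS s m k × (∀ n → AsMDS s n k → n ≤ m)

{-# OPTIONS --safe #-}

-- A code is handled as a list of nonzero vectors of F^k together with M, the largest
-- number of its points on one hyperplane; Singleton defect s means M = k − 1 + s.
-- Three operations change the length n and M:
--   * repeating a point that lies on a maximal hyperplane gives (n + 1, M + 1);
--   * concatenating two codes gives (n₁ + n₂, T) with T ≤ M₁ + M₂, and repetitions raise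
--     T to M₁ + M₂ = (k − 1) + (k − 1 + s₁ + s₂);
--   * projecting from a point P on a maximal hyperplane to F^(k−1) loses the c ≥ 1 points
--     proportional to P and gives (n − c, M − c); repeating c − 1 points restores the
--     defect, so a code of length n in F^k yields one of length n − 1 in F^(k−1).
-- Repetition needs M ≥ 1, which the Singleton bound M ≥ k − 1 (proved by the same
-- projection) provides for k ≥ 2. In F^1 no point lies on a hyperplane, so every point
-- can be repeated and m^s(1,q) does not exist; in F^0 there is no code at all.

module Submission where

open import Algebra.Bundles using (CommutativeRing)
open import Algebra.Structures using (IsCommutativeRing)
open import Data.Empty using (⊥-elim)
open import Data.Fin as Fin using (Fin; punchIn; punchOut)
open import Data.Fin.Properties as Finₚ using (any?)
open import Data.List using (List; []; _∷_; [_]; _++_; length; map; filter; tabulate; lookup; cartesianProductWith)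
open import Data.List.Extrema.Nat using (argmax; argmax-all; f[xs]≤f[argmax])
open import Data.List.Membership.Propositional using (_∈_; find; lose)
open import Data.List.Membership.Propositional.Properties using (∈-tabulate⁺; ∈-lookup; ∈-filter⁺; ∈-cartesianProductWith⁺)
open import Data.List.Properties using (length-++; length-map; length-filter; length-tabulate; filter-++; filter-accept; filter-reject; filter-some; map-++; map-cong; map-∘; map-tabulate; tabulate-lookup)
open import Data.List.Relation.Unary.All as All using (All; _∷_)
open import Data.List.Relation.Unary.All.Properties using (all-filter) renaming (++⁺ to All-++⁺; tabulate⁺ to All-tabulate⁺)
open import Data.List.Relation.Unary.Any as Any using (Any; here; there)
open import Data.List.Relation.Unary.Any.Properties using (lookup-index; lookup-result) renaming (++⁺ˡ to Any-++⁺ˡ; tabulate⁺ to Any-tabulate⁺; map⁺ to Any-map⁺; filter⁺ to Any-filter⁺)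
open import Data.Nat using (ℕ; zero; suc; _+_; _*_; _∸_; _≤_; _<_; z≤n; s≤s)
open import Data.Nat.Properties as ℕₚ using (≤-refl; ≤-trans; +-mono-≤)
open import Data.Nat.Tactic.RingSolver using (solve-∀)
open import Data.Product using (Σ; ∃; _×_; _,_; proj₁; proj₂)
open import Data.Sum using (inj₁; inj₂)
open import Data.Vec.Functional using (removeAt; insertAt) renaming (_∷_ to _∷ᵥ_)
open import Data.Vec.Functional.Properties using (insertAt-lookup; insertAt-punchIn; removeAt-insertAt; removeAt-punchOut)
open import Function using (_∘_)
open import Function.Bundles using (Inverse)
open import Level using (0ℓ)
open import Relation.Binary.PropositionalEquality using (_≡_; _≢_; _≗_; refl; sym; trans; cong; cong₂; subst; subst₂; module ≡-Reasoning)
open import Relation.Nullary using (¬_; yes; no; ¬?)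
open import Relation.Nullary.Decidable using (decidable-stable)
open import Relation.Unary using (Decidable)
open import Relation.Unary.Properties using (∁?)
open import Algebra.Properties.CommutativeSemigroup ℕₚ.+-commutativeSemigroup using (x∙yz≈y∙xz)
import Algebra.Solver.CommutativeMonoid as CommutativeMonoidSolver
open import Defs

length-filter-∁ : ∀ {A : Set} {P : A → Set} (P? : Decidable P) (xs : List A) →
                  length (filter (∁? P?) xs) + length (filter P? xs) ≡ length xs
length-filter-∁ P? [] = refl
length-filter-∁ P? (x ∷ xs) with P? x
... | yes _ = trans (ℕₚ.+-suc _ _) (cong suc (length-filter-∁ P? xs))
... | no _ = cong suc (length-filter-∁ P? xs)

module _ {q : ℕ} (F : FiniteField q) where

  open FiniteField F
  open IsCommutativeRing isCommutativeRing
    using (+-comm; +-identityʳ; -‿inverseˡ; -‿inverseʳ; zeroˡ; zeroʳ; *-comm; *-identityˡ; *-identityʳ; distribˡ)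

  commutativeRing : CommutativeRing 0ℓ 0ℓ
  commutativeRing = record { isCommutativeRing = isCommutativeRing }

  open import Algebra.Properties.Ring (CommutativeRing.ring commutativeRing)
    using (-‿distribˡ-*; -‿distribʳ-*; -‿involutive; +-inverseʳ-unique; -1*x≈-x)
  open import Algebra.Properties.Semiring.Sum (CommutativeRing.semiring commutativeRing)
    using (sum; sum-cong-≗; sum-remove; sum-replicate-zero; ∑-distrib-+; *-distribˡ-sum)
  open CommutativeMonoidSolver (CommutativeRing.*-commutativeMonoid commutativeRing)
    using (_⊜_) renaming (solve to solve-*; _⊕_ to _⊗_)

  infix 25 _·_
  _·_ : ∀ {k} → Vec F k → Vec F k → Carrier
  u · v = dot F u v

  private
    variable
      k n n₁ n₂ m m′ m₀ m₁ m₂ M M₁ M₂ r s s₁ s₂ t : ℕ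

  zero-divisor : ∀ {a b} → a ≢ 0F → a *F b ≡ 0F → b ≡ 0F
  zero-divisor {a} {b} a≢0 ab≡0 with inverse a a≢0
  ... | a⁻¹ , aa⁻¹≡1 = begin
    b                    ≡⟨ sym (*-identityˡ b) ⟩
    1F *F b              ≡⟨ cong (_*F b) (sym aa⁻¹≡1) ⟩
    (a *F a⁻¹) *F b      ≡⟨ solve-* 3 (λ a a⁻¹ b → (a ⊗ a⁻¹) ⊗ b ⊜ a⁻¹ ⊗ (a ⊗ b)) refl a a⁻¹ b ⟩
    a⁻¹ *F (a *F b)      ≡⟨ cong (a⁻¹ *F_) ab≡0 ⟩
    a⁻¹ *F 0F            ≡⟨ zeroʳ a⁻¹ ⟩
    0F                   ∎
    where open ≡-Reasoning

  -a*-b≡a*b : ∀ a b → (-F a) *F (-F b) ≡ a *F b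
  -a*-b≡a*b a b = begin
    (-F a) *F (-F b)   ≡⟨ sym (-‿distribˡ-* a (-F b)) ⟩
    -F (a *F (-F b))   ≡⟨ cong -F_ (sym (-‿distribʳ-* a b)) ⟩
    -F (-F (a *F b))   ≡⟨ -‿involutive (a *F b) ⟩
    a *F b             ∎
    where open ≡-Reasoning

  nonZero? : Decidable (NonZero F {k})
  nonZero? v = any? (λ j → ¬? (v j ≟ 0F))

  ¬nonZero⇒≡0 : {v : Vec F k} → ¬ NonZero F v → ∀ j → v j ≡ 0F
  ¬nonZero⇒≡0 v≡0 j = decidable-stable (_ ≟ 0F) (λ vⱼ≢0 → v≡0 (j , vⱼ≢0))

  removeAt-≡0 : (i : Fin (suc k)) (u : Vec F (suc k)) → u i ≡ 0F → (∀ j → removeAt u i j ≡ 0F) → ∀ j → u j ≡ 0F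
  removeAt-≡0 i u uᵢ≡0 u′≡0 j with i Finₚ.≟ j
  ... | yes refl = uᵢ≡0
  ... | no i≢j = trans (sym (removeAt-punchOut u i≢j)) (u′≡0 (punchOut i≢j))

  ones : Vec F (suc k)
  ones _ = 1F

  ones-nonZero : NonZero F (ones {k})
  ones-nonZero = Fin.zero , 0≢1 ∘ sym

  dot≡sum : (u v : Vec F k) → u · v ≡ sum (λ j → u j *F v j)
  dot≡sum {zero} u v = refl
  dot≡sum {suc k} u v = cong ((u Fin.zero *F v Fin.zero) +F_) (dot≡sum (u ∘ Fin.suc) (v ∘ Fin.suc))

  dot-cong : {u u′ v v′ : Vec F k} → u ≗ u′ → v ≗ v′ → u · v ≡ u′ · v′
  dot-cong {zero} _ _ = refl
  dot-cong {suc k} u≗u′ v≗v′ =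
    cong₂ _+F_ (cong₂ _*F_ (u≗u′ Fin.zero) (v≗v′ Fin.zero)) (dot-cong (u≗u′ ∘ Fin.suc) (v≗v′ ∘ Fin.suc))

  dot-zeroˡ : (u v : Vec F k) → (∀ j → u j ≡ 0F) → u · v ≡ 0F
  dot-zeroˡ {k} u v u≡0 = begin
    u · v                    ≡⟨ dot≡sum u v ⟩
    sum (λ j → u j *F v j)   ≡⟨ sum-cong-≗ (λ j → trans (cong (_*F v j) (u≡0 j)) (zeroˡ (v j))) ⟩
    sum {k} (λ _ → 0F)       ≡⟨ sum-replicate-zero k ⟩
    0F                       ∎
    where open ≡-Reasoning

  dot-zeroʳ : (u v : Vec F k) → (∀ j → v j ≡ 0F) → u · v ≡ 0F
  dot-zeroʳ {k} u v v≡0 = begin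
    u · v                    ≡⟨ dot≡sum u v ⟩
    sum (λ j → u j *F v j)   ≡⟨ sum-cong-≗ (λ j → trans (cong (u j *F_) (v≡0 j)) (zeroʳ (u j))) ⟩
    sum {k} (λ _ → 0F)       ≡⟨ sum-replicate-zero k ⟩
    0F                       ∎
    where open ≡-Reasoning

  dot-removeAt : (i : Fin (suc k)) (u v : Vec F (suc k)) →
                 u · v ≡ (u i *F v i) +F (removeAt u i · removeAt v i)
  dot-removeAt i u v = begin
    u · v                                                ≡⟨ dot≡sum u v ⟩
    sum (λ j → u j *F v j)                               ≡⟨ sum-remove {i = i} (λ j → u j *F v j) ⟩
    (u i *F v i) +F sum (removeAt (λ j → u j *F v j) i)  ≡⟨ cong ((u i *F v i) +F_) (sym (dot≡sum (removeAt u i) (removeAt v i))) ⟩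
    (u i *F v i) +F (removeAt u i · removeAt v i)        ∎
    where open ≡-Reasoning

  dot-linearʳ : (u v w : Vec F k) (c : Carrier) →
                u · (λ j → v j +F (c *F w j)) ≡ (u · v) +F (c *F (u · w))
  dot-linearʳ u v w c = begin
    u · (λ j → v j +F (c *F w j))                            ≡⟨ dot≡sum u _ ⟩
    sum (λ j → u j *F (v j +F (c *F w j)))                   ≡⟨ sum-cong-≗ distrib ⟩
    sum (λ j → (u j *F v j) +F (c *F (u j *F w j)))          ≡⟨ ∑-distrib-+ (λ j → u j *F v j) (λ j → c *F (u j *F w j)) ⟩
    sum (λ j → u j *F v j) +F sum (λ j → c *F (u j *F w j))  ≡⟨ cong₂ _+F_ (sym (dot≡sum u v)) (sym (*-distribˡ-sum c (λ j → u j *F w j))) ⟩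
    (u · v) +F (c *F sum (λ j → u j *F w j))                 ≡⟨ cong (λ t → (u · v) +F (c *F t)) (sym (dot≡sum u w)) ⟩
    (u · v) +F (c *F (u · w))                                ∎
    where
    open ≡-Reasoning
    distrib : ∀ j → u j *F (v j +F (c *F w j)) ≡ (u j *F v j) +F (c *F (u j *F w j))
    distrib j = trans (distribˡ (u j) (v j) (c *F w j))
                      (cong ((u j *F v j) +F_) (solve-* 3 (λ a b c → a ⊗ (b ⊗ c) ⊜ b ⊗ (a ⊗ c)) refl (u j) c (w j)))

  dim1-dot≢0 : {u x : Vec F 1} → NonZero F u → NonZero F x → u · x ≢ 0F
  dim1-dot≢0 (Fin.zero , u₀≢0) (Fin.zero , x₀≢0) u·x≡0 = x₀≢0 (zero-divisor u₀≢0 (trans (sym (+-identityʳ _)) u·x≡0))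

  zeros : List Carrier → ℕ
  zeros = length ∘ filter (_≟ 0F)

  meets : Vec F k → List (Vec F k) → ℕ
  meets u L = zeros (map (u ·_) L)

  count≡zeros : ∀ {n} (f : Fin n → Carrier) → count F f ≡ zeros (tabulate f)
  count≡zeros {zero} f = refl
  count≡zeros {suc n} f with f Fin.zero ≟ 0F
  ... | yes _ = cong suc (count≡zeros (f ∘ Fin.suc))
  ... | no _ = count≡zeros (f ∘ Fin.suc)

  meet≡meets : (G : ProjSystem F n k) (u : Vec F k) → meet F G u ≡ meets u (tabulate (ProjSystem.pt G))
  meet≡meets G u =
    trans (count≡zeros (λ i → u · ProjSystem.pt G i)) (cong zeros (sym (map-tabulate (ProjSystem.pt G) (u ·_))))

  meets-++ : (u : Vec F k) (L₁ L₂ : List (Vec F k)) → meets u (L₁ ++ L₂) ≡ meets u L₁ + meets u L₂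
  meets-++ u L₁ L₂ = trans (cong zeros (map-++ (u ·_) L₁ L₂))
    (trans (cong length (filter-++ (_≟ 0F) (map (u ·_) L₁) _)) (length-++ (filter (_≟ 0F) (map (u ·_) L₁))))

  meets-∷ : (u x : Vec F k) (L : List (Vec F k)) → meets u (x ∷ L) ≡ meets u [ x ] + meets u L
  meets-∷ u x = meets-++ u [ x ]

  meets-∷-on : (u x : Vec F k) (L : List (Vec F k)) → u · x ≡ 0F → meets u (x ∷ L) ≡ suc (meets u L)
  meets-∷-on u x L u·x≡0 = cong length (filter-accept (_≟ 0F) u·x≡0)

  meets-∷-off : (u x : Vec F k) (L : List (Vec F k)) → u · x ≢ 0F → meets u (x ∷ L) ≡ meets u L
  meets-∷-off u x L u·x≢0 = cong length (filter-reject (_≟ 0F) u·x≢0)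

  meets≤length : (u : Vec F k) (L : List (Vec F k)) → meets u L ≤ length L
  meets≤length u L = ≤-trans (length-filter (_≟ 0F) (map (u ·_) L)) (ℕₚ.≤-reflexive (length-map (u ·_) L))

  meets-pos : (u : Vec F k) (L : List (Vec F k)) → 0 < meets u L → Any (λ x → u · x ≡ 0F) L
  meets-pos u (x ∷ L) pos with u · x ≟ 0F
  ... | yes u·x≡0 = here u·x≡0
  ... | no _ = there (meets-pos u L pos)

  meets-cong : {u u′ : Vec F k} → u ≗ u′ → ∀ L → meets u L ≡ meets u′ L
  meets-cong u≗u′ L = cong zeros (map-cong (λ x → dot-cong u≗u′ (λ _ → refl)) L)

  meets-map : ∀ {k′} (u : Vec F k) (u′ : Vec F k′) (f : Vec F k → Vec F k′) →
              (∀ x → u · x ≡ u′ · f x) → ∀ L → meets u L ≡ meets u′ (map f L)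
  meets-map u u′ f u·x≡u′·fx L = cong zeros (trans (map-cong u·x≡u′·fx L) (map-∘ L))

  meets-filter-nonZero : (u : Vec F k) (L : List (Vec F k)) →
                         meets u L ≡ length (filter (∁? nonZero?) L) + meets u (filter nonZero? L)
  meets-filter-nonZero u [] = refl
  meets-filter-nonZero u (x ∷ L) with nonZero? x
  ... | yes _ = begin
    meets u (x ∷ L)                  ≡⟨ meets-∷ u x L ⟩
    meets u [ x ] + meets u L        ≡⟨ cong (meets u [ x ] +_) (meets-filter-nonZero u L) ⟩
    meets u [ x ] + (Z + meets u N)  ≡⟨ x∙yz≈y∙xz (meets u [ x ]) Z (meets u N) ⟩
    Z + (meets u [ x ] + meets u N)  ≡⟨ cong (Z +_) (sym (meets-∷ u x N)) ⟩
    Z + meets u (x ∷ N)              ∎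
    where
    open ≡-Reasoning
    Z = length (filter (∁? nonZero?) L)
    N = filter nonZero? L
  ... | no x≡0 = trans (meets-∷-on u x L (dot-zeroʳ u x (¬nonZero⇒≡0 x≡0))) (cong suc (meets-filter-nonZero u L))

  Spanning : List (Vec F k) → Set
  Spanning {k} L = (u : Vec F k) → NonZero F u → Any (λ x → u · x ≢ 0F) L

  spanning-filter-nonZero : {L : List (Vec F k)} → Spanning L → Spanning (filter nonZero? L)
  spanning-filter-nonZero span u u≢0 with Any-filter⁺ nonZero? (span u u≢0)
  ... | inj₁ off = off
  ... | inj₂ x≡0 = ⊥-elim (lookup-result (span u u≢0) (dot-zeroʳ u _ (¬nonZero⇒≡0 x≡0)))

  record MaxMeet (L : List (Vec F k)) (M : ℕ) : Set where
    field
      hyperplane : Vec F k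
      hyperplane-nonZero : NonZero F hyperplane
      meets-hyperplane : meets hyperplane L ≡ M
      meets≤ : ∀ u → NonZero F u → meets u L ≤ M

  -- M is the paper's n − d.
  record Code (L : List (Vec F k)) (M : ℕ) : Set where
    field
      nonZero : All (NonZero F) L
      spanning : Spanning L
      maxMeet : MaxMeet L M

  Code≥ : (k n M : ℕ) → Set
  Code≥ k n M = Σ (List (Vec F k)) λ L → n ≤ length L × Code L M

  Code≥-weaken : n₁ ≤ n₂ → Code≥ k n₂ M → Code≥ k n₁ M
  Code≥-weaken n₁≤n₂ (L , n₂≤length , C) = L , ≤-trans n₁≤n₂ n₂≤length , C

  code-∷ : {x : Vec F k} {L : List (Vec F k)} → NonZero F x → Code L M → MaxMeet (x ∷ L) M₁ → Code (x ∷ L) M₁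
  code-∷ x≢0 C maxMeet = record
    { nonZero = x≢0 ∷ Code.nonZero C
    ; spanning = λ u u≢0 → there (Code.spanning C u u≢0)
    ; maxMeet = maxMeet
    }

  elements : List Carrier
  elements = tabulate (Inverse.from size)

  ∈-elements : ∀ c → c ∈ elements
  ∈-elements c = subst (_∈ elements) (Inverse.strictlyInverseʳ size c) (∈-tabulate⁺ (Inverse.to size c))

  vectors : ∀ k → List (Vec F k)
  vectors zero = [ (λ ()) ]
  vectors (suc k) = cartesianProductWith _∷ᵥ_ elements (vectors k)

  vectors-complete : (v : Vec F k) → ∃ λ w → w ∈ vectors k × v ≗ w
  vectors-complete {zero} v = _ , here refl , λ ()
  vectors-complete {suc k} v with vectors-complete (v ∘ Fin.suc)
  ... | w , w∈vectors , tail≗w =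
    v Fin.zero ∷ᵥ w ,
    ∈-cartesianProductWith⁺ _∷ᵥ_ (∈-elements (v Fin.zero)) w∈vectors ,
    λ { Fin.zero → refl ; (Fin.suc j) → tail≗w j }

  maxMeet-exists : (L : List (Vec F (suc k))) → ∃ (MaxMeet L)
  maxMeet-exists {k} L = meets u* L , record
    { hyperplane = u*
    ; hyperplane-nonZero = argmax-all f ones-nonZero (all-filter nonZero? (vectors (suc k)))
    ; meets-hyperplane = refl
    ; meets≤ = meets≤u*
    }
    where
    f : Vec F (suc k) → ℕ
    f u = meets u L
    candidates : List (Vec F (suc k))
    candidates = filter nonZero? (vectors (suc k))
    u* : Vec F (suc k)
    u* = argmax f ones candidates
    meets≤u* : ∀ u → NonZero F u → f u ≤ f u*
    meets≤u* u (j , uⱼ≢0) with vectors-complete u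
    ... | w , w∈vectors , u≗w =
      subst (_≤ f u*) (sym (meets-cong u≗w L))
        (All.lookup (f[xs]≤f[argmax] ones candidates) (∈-filter⁺ nonZero? w∈vectors (j , uⱼ≢0 ∘ trans (u≗w j))))

  defect-equation : ∀ r s d → r + s + d + 1 ≡ suc r + d + s
  defect-equation = solve-∀

  fromAsMDS : AsMDS F s n (suc r) → Code≥ (suc r) n (r + s)
  fromAsMDS {s} {n} {r} (G , nondegenerate , d , (meet+d≤n , u₀ , u₀≢0 , meet₀+d≡n) , n+1≡) =
    tabulate pt , ℕₚ.≤-reflexive (sym (length-tabulate pt)) , record
      { nonZero = All-tabulate⁺ pt-nonzero
      ; spanning = λ u u≢0 → Any-tabulate⁺ (proj₁ (nondegenerate u u≢0)) (proj₂ (nondegenerate u u≢0))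
      ; maxMeet = record
        { hyperplane = u₀
        ; hyperplane-nonZero = u₀≢0
        ; meets-hyperplane = trans (sym (meet≡meets G u₀)) (ℕₚ.+-cancelʳ-≡ d _ _ (trans meet₀+d≡n n≡r+s+d))
        ; meets≤ = λ u u≢0 → ℕₚ.+-cancelʳ-≤ d _ _
                     (subst₂ _≤_ (cong (_+ d) (meet≡meets G u)) n≡r+s+d (meet+d≤n u u≢0))
        }
      }
    where
    open ProjSystem G
    n≡r+s+d : n ≡ r + s + d
    n≡r+s+d = ℕₚ.+-cancelʳ-≡ 1 _ _ (trans n+1≡ (sym (defect-equation r s d)))

  toAsMDS : {L : List (Vec F (suc r))} → Code L (r + s) → AsMDS F s (length L) (suc r)
  toAsMDS {r} {s} {L} C = G , nondegenerate , d , (meet+d≤n , hyperplane , hyperplane-nonZero , meet₀+d≡n) , n+1≡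
    where
    open Code C
    open MaxMeet maxMeet
    G : ProjSystem F (length L) (suc r)
    G = record { pt = lookup L ; pt-nonzero = λ i → All.lookup nonZero (∈-lookup i) }
    meet≡meets-L : ∀ u → meet F G u ≡ meets u L
    meet≡meets-L u = trans (meet≡meets G u) (cong (meets u) (tabulate-lookup L))
    nondegenerate : NonDegenerate F G
    nondegenerate u u≢0 = Any.index (spanning u u≢0) , lookup-index (spanning u u≢0)
    d : ℕ
    d = length L ∸ (r + s)
    r+s+d≡n : r + s + d ≡ length L
    r+s+d≡n = ℕₚ.m+[n∸m]≡n (subst (_≤ length L) meets-hyperplane (meets≤length hyperplane L))
    meet+d≤n : ∀ u → NonZero F u → meet F G u + d ≤ length L
    meet+d≤n u u≢0 = subst (meet F G u + d ≤_) r+s+d≡n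
                       (ℕₚ.+-monoˡ-≤ d (subst (_≤ r + s) (sym (meet≡meets-L u)) (meets≤ u u≢0)))
    meet₀+d≡n : meet F G hyperplane + d ≡ length L
    meet₀+d≡n = trans (cong (_+ d) (trans (meet≡meets-L hyperplane) meets-hyperplane)) r+s+d≡n
    n+1≡ : length L + 1 ≡ suc r + d + s
    n+1≡ = trans (cong (_+ 1) (sym r+s+d≡n)) (defect-equation r s d)

  maxLen-code : IsMaxLen F s (suc r) m → Code≥ (suc r) m (r + s)
  maxLen-code (code , _) = fromAsMDS code

  maxLen-≥ : IsMaxLen F s (suc r) m → Code≥ (suc r) n (r + s) → n ≤ m
  maxLen-≥ (_ , maximal) (L , n≤length , C) = ≤-trans n≤length (maximal (length L) (toAsMDS C))

  -- Projection from P to F^k, pivoting on a coordinate i with P i ≠ 0 and y = (P i)⁻¹: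
  -- with ′ deleting coordinate i, π x = x′ − (x i / P i) P′.  A hyperplane u through P
  -- satisfies u · x = u′ · π x, and lift is the inverse of u ↦ u′ on such hyperplanes.
  module Projection (P : Vec F (suc k)) (P≢0 : NonZero F P) where

    i : Fin (suc k)
    i = proj₁ P≢0

    y : Carrier
    y = proj₁ (inverse (P i) (proj₂ P≢0))

    Pᵢy≡1 : P i *F y ≡ 1F
    Pᵢy≡1 = proj₂ (inverse (P i) (proj₂ P≢0))

    P′ : Vec F k
    P′ = removeAt P i

    π : Vec F (suc k) → Vec F k
    π x j = removeAt x i j +F ((-F (x i *F y)) *F P′ j)

    π-P≡0 : ∀ j → π P j ≡ 0F
    π-P≡0 j = begin
      P′ j +F ((-F (P i *F y)) *F P′ j)   ≡⟨ cong (λ t → P′ j +F ((-F t) *F P′ j)) Pᵢy≡1 ⟩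
      P′ j +F ((-F 1F) *F P′ j)           ≡⟨ cong (P′ j +F_) (-1*x≈-x (P′ j)) ⟩
      P′ j +F (-F P′ j)                   ≡⟨ -‿inverseʳ (P′ j) ⟩
      0F                                  ∎
      where open ≡-Reasoning

    ·-π : (u : Vec F (suc k)) → u · P ≡ 0F → ∀ x → u · x ≡ removeAt u i · π x
    ·-π u u·P≡0 x = begin
      u · x                          ≡⟨ dot-removeAt i u x ⟩
      (u i *F x i) +F (u′ · x′)      ≡⟨ +-comm _ _ ⟩
      (u′ · x′) +F (u i *F x i)      ≡⟨ cong ((u′ · x′) +F_) (sym c*u′·P′≡uᵢxᵢ) ⟩
      (u′ · x′) +F (c *F (u′ · P′))  ≡⟨ sym (dot-linearʳ u′ x′ P′ c) ⟩
      u′ · π x                       ∎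
      where
      open ≡-Reasoning
      u′ = removeAt u i
      x′ = removeAt x i
      c = -F (x i *F y)
      u′·P′≡ : u′ · P′ ≡ -F (u i *F P i)
      u′·P′≡ = +-inverseʳ-unique (u i *F P i) (u′ · P′) (trans (sym (dot-removeAt i u P)) u·P≡0)
      c*u′·P′≡uᵢxᵢ : c *F (u′ · P′) ≡ u i *F x i
      c*u′·P′≡uᵢxᵢ = begin
        c *F (u′ · P′)               ≡⟨ cong (c *F_) u′·P′≡ ⟩
        c *F (-F (u i *F P i))       ≡⟨ -a*-b≡a*b (x i *F y) (u i *F P i) ⟩
        (x i *F y) *F (u i *F P i)   ≡⟨ solve-* 4 (λ a b c d → (a ⊗ b) ⊗ (c ⊗ d) ⊜ (c ⊗ a) ⊗ (d ⊗ b)) refl (x i) y (u i) (P i) ⟩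
        (u i *F x i) *F (P i *F y)   ≡⟨ cong ((u i *F x i) *F_) Pᵢy≡1 ⟩
        (u i *F x i) *F 1F           ≡⟨ *-identityʳ (u i *F x i) ⟩
        u i *F x i                   ∎

    removeAt-nonZero : {u : Vec F (suc k)} → NonZero F u → u · P ≡ 0F → NonZero F (removeAt u i)
    removeAt-nonZero {u} (j , uⱼ≢0) u·P≡0 with nonZero? (removeAt u i)
    ... | yes u′≢0 = u′≢0
    ... | no u′≡0 = ⊥-elim (uⱼ≢0 (removeAt-≡0 i u uᵢ≡0 (¬nonZero⇒≡0 u′≡0) j))
      where
      open ≡-Reasoning
      uᵢ≡0 : u i ≡ 0F
      uᵢ≡0 = zero-divisor (proj₂ P≢0) (begin
        P i *F u i                           ≡⟨ *-comm (P i) (u i) ⟩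
        u i *F P i                           ≡⟨ sym (+-identityʳ _) ⟩
        (u i *F P i) +F 0F                   ≡⟨ cong ((u i *F P i) +F_) (sym (dot-zeroˡ _ P′ (¬nonZero⇒≡0 u′≡0))) ⟩
        (u i *F P i) +F (removeAt u i · P′)  ≡⟨ sym (dot-removeAt i u P) ⟩
        u · P                                ≡⟨ u·P≡0 ⟩
        0F                                   ∎)

    lift : Vec F k → Vec F (suc k)
    lift u′ = insertAt u′ i (-F ((u′ · P′) *F y))

    lift-removeAt : ∀ u′ → removeAt (lift u′) i ≗ u′
    lift-removeAt u′ = removeAt-insertAt u′ i (-F ((u′ · P′) *F y))

    lift·P≡0 : ∀ u′ → lift u′ · P ≡ 0F
    lift·P≡0 u′ = begin
      lift u′ · P                                        ≡⟨ dot-removeAt i (lift u′) P ⟩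
      (lift u′ i *F P i) +F (removeAt (lift u′) i · P′)  ≡⟨ cong₂ _+F_ (cong (_*F P i) (insertAt-lookup u′ i _))
                                                                       (dot-cong (lift-removeAt u′) (λ _ → refl)) ⟩
      ((-F (D *F y)) *F P i) +F D                        ≡⟨ cong (_+F D) (sym (-‿distribˡ-* (D *F y) (P i))) ⟩
      (-F ((D *F y) *F P i)) +F D                        ≡⟨ cong (λ t → (-F t) +F D)
                                                              (solve-* 3 (λ a b c → (a ⊗ b) ⊗ c ⊜ a ⊗ (c ⊗ b)) refl D y (P i)) ⟩
      (-F (D *F (P i *F y))) +F D                        ≡⟨ cong (λ t → (-F (D *F t)) +F D) Pᵢy≡1 ⟩
      (-F (D *F 1F)) +F D                                ≡⟨ cong (λ t → (-F t) +F D) (*-identityʳ D) ⟩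
      (-F D) +F D                                        ≡⟨ -‿inverseˡ D ⟩
      0F                                                 ∎
      where
      open ≡-Reasoning
      D = u′ · P′

    lift-· : ∀ u′ x → lift u′ · x ≡ u′ · π x
    lift-· u′ x = trans (·-π (lift u′) (lift·P≡0 u′) x) (dot-cong (lift-removeAt u′) (λ _ → refl))

    lift-nonZero : {u′ : Vec F k} → NonZero F u′ → NonZero F (lift u′)
    lift-nonZero {u′} (j , u′ⱼ≢0) = punchIn i j , u′ⱼ≢0 ∘ trans (sym (insertAt-punchIn u′ i _ j))

    projected : List (Vec F (suc k)) → List (Vec F k)
    projected L = filter nonZero? (map π L)

    -- the number of points of L proportional to P
    collapsed : List (Vec F (suc k)) → ℕ
    collapsed L = length (filter (∁? nonZero?) (map π L))

    length-projected : ∀ L → collapsed L + length (projected L) ≡ length L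
    length-projected L = trans (length-filter-∁ nonZero? (map π L)) (length-map π L)

    collapsed-pos : ∀ {L} → P ∈ L → 0 < collapsed L
    collapsed-pos P∈L = filter-some (∁? nonZero?) (Any-map⁺ (lose P∈L (λ (j , πPⱼ≢0) → πPⱼ≢0 (π-P≡0 j))))

    meets-projected : (u : Vec F (suc k)) (u′ : Vec F k) → (∀ x → u · x ≡ u′ · π x) →
                      ∀ L → meets u L ≡ collapsed L + meets u′ (projected L)
    meets-projected u u′ u·x≡u′·πx L = trans (meets-map u u′ π u·x≡u′·πx L) (meets-filter-nonZero u′ (map π L))

    projected-nonZero : ∀ L → All (NonZero F) (projected L)
    projected-nonZero L = all-filter nonZero? (map π L)

    projected-spanning : {L : List (Vec F (suc k))} → Spanning L → Spanning (projected L)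
    projected-spanning {L} span = spanning-filter-nonZero {L = map π L} λ u′ u′≢0 →
      Any-map⁺ (Any.map (λ {x} off → off ∘ trans (lift-· u′ x)) (span (lift u′) (lift-nonZero u′≢0)))

    projected-maxMeet : {L : List (Vec F (suc k))} (maxMeet : MaxMeet L M) → MaxMeet.hyperplane maxMeet · P ≡ 0F →
                        ∃ λ T → collapsed L + T ≡ M × MaxMeet (projected L) T
    projected-maxMeet {M} {L} maxMeet u₀·P≡0 = meets (removeAt u₀ i) (projected L) , c+T≡M , record
      { hyperplane = removeAt u₀ i
      ; hyperplane-nonZero = removeAt-nonZero hyperplane-nonZero u₀·P≡0
      ; meets-hyperplane = refl
      ; meets≤ = λ u′ u′≢0 → ℕₚ.+-cancelˡ-≤ (collapsed L) _ _
          (subst₂ _≤_ (meets-projected (lift u′) u′ (lift-· u′) L) (sym c+T≡M) (meets≤ (lift u′) (lift-nonZero u′≢0)))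
      }
      where
      open MaxMeet maxMeet renaming (hyperplane to u₀)
      c+T≡M : collapsed L + meets (removeAt u₀ i) (projected L) ≡ M
      c+T≡M = trans (sym (meets-projected u₀ (removeAt u₀ i) (·-π u₀ u₀·P≡0) L)) meets-hyperplane

  singleton-bound : {L : List (Vec F (suc r))} → All (NonZero F) L → Spanning L →
                    ∃ λ u → NonZero F u × r ≤ meets u L
  singleton-bound {zero} _ _ = ones , ones-nonZero , z≤n
  singleton-bound {suc r} {L} L≢0 span with find (span ones ones-nonZero)
  ... | P , P∈L , _ = lifted (singleton-bound (projected-nonZero L) (projected-spanning span))
    where
    open Projection P (All.lookup L≢0 P∈L)
    lifted : (∃ λ u′ → NonZero F u′ × r ≤ meets u′ (projected L)) → ∃ λ u → NonZero F u × suc r ≤ meets u L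
    lifted (u′ , u′≢0 , r≤meets) = lift u′ , lift-nonZero u′≢0 ,
      subst (suc r ≤_) (sym (meets-projected (lift u′) u′ (lift-· u′) L)) (+-mono-≤ (collapsed-pos P∈L) r≤meets)

  code-singleton : {L : List (Vec F (suc r))} → Code L M → r ≤ M
  code-singleton C with singleton-bound (Code.nonZero C) (Code.spanning C)
  ... | u , u≢0 , r≤meets = ≤-trans r≤meets (MaxMeet.meets≤ (Code.maxMeet C) u u≢0)

  pad : 1 ≤ M → Code≥ k n M → Code≥ k (suc n) (suc M)
  pad {M} {k} 1≤M (L , n≤length , C) = x ∷ L , s≤s n≤length , code-∷ (All.lookup nonZero x∈L) C (record
    { hyperplane = hyperplane
    ; hyperplane-nonZero = hyperplane-nonZero
    ; meets-hyperplane = trans (meets-∷-on hyperplane x L on) (cong suc meets-hyperplane)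
    ; meets≤ = λ u u≢0 → subst (_≤ suc M) (sym (meets-∷ u x L)) (+-mono-≤ (meets≤length u [ x ]) (meets≤ u u≢0))
    })
    where
    open Code C
    open MaxMeet maxMeet
    point : ∃ λ x → x ∈ L × hyperplane · x ≡ 0F
    point = find (meets-pos hyperplane L (≤-trans 1≤M (ℕₚ.≤-reflexive (sym meets-hyperplane))))
    x : Vec F k
    x = proj₁ point
    x∈L : x ∈ L
    x∈L = proj₁ (proj₂ point)
    on : hyperplane · x ≡ 0F
    on = proj₂ (proj₂ point)

  padMany : 1 ≤ M → Code≥ k n M → ∀ j → Code≥ k (j + n) (j + M)
  padMany 1≤M C zero = C
  padMany {M} 1≤M C (suc j) = pad (≤-trans 1≤M (ℕₚ.m≤n+m M j)) (padMany 1≤M C j)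

  shorten : Code≥ (3 + r) n (suc M) → Code≥ (2 + r) (n ∸ 1) M
  shorten {r} {n} {M} (L , n≤length , C) =
    Code≥-weaken n∸1≤j+length (subst (Code≥ _ _) j+T≡M (padMany 1≤T (projected L , ≤-refl , C′) j))
    where
    open Code C
    open MaxMeet maxMeet renaming (hyperplane to u₀)
    point : ∃ λ P → P ∈ L × u₀ · P ≡ 0F
    point = find (meets-pos u₀ L (subst (0 <_) (sym meets-hyperplane) (s≤s z≤n)))
    P∈L : proj₁ point ∈ L
    P∈L = proj₁ (proj₂ point)
    open Projection (proj₁ point) (All.lookup nonZero P∈L)
    projection : ∃ λ T → collapsed L + T ≡ suc M × MaxMeet (projected L) T
    projection = projected-maxMeet maxMeet (proj₂ (proj₂ point))
    T : ℕ
    T = proj₁ projection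
    C′ : Code (projected L) T
    C′ = record { nonZero = projected-nonZero L ; spanning = projected-spanning spanning ; maxMeet = proj₂ (proj₂ projection) }
    1≤T : 1 ≤ T
    1≤T = ≤-trans (s≤s z≤n) (code-singleton C′)
    1≤c : 1 ≤ collapsed L
    1≤c = collapsed-pos P∈L
    j : ℕ
    j = collapsed L ∸ 1
    j+T≡M : j + T ≡ M
    j+T≡M = trans (sym (ℕₚ.+-∸-comm T 1≤c)) (cong (_∸ 1) (proj₁ (proj₂ projection)))
    n∸1≤j+length : n ∸ 1 ≤ j + length (projected L)
    n∸1≤j+length = ≤-trans (ℕₚ.∸-monoˡ-≤ 1 n≤length)
      (ℕₚ.≤-reflexive (trans (cong (_∸ 1) (sym (length-projected L))) (ℕₚ.+-∸-comm _ 1≤c)))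

  shortenMany : ∀ α → Code≥ (2 + (α + r)) n (α + M) → Code≥ (2 + r) (n ∸ α) M
  shortenMany zero C = C
  shortenMany {r} {n} {M} (suc α) C =
    subst (λ n′ → Code≥ (2 + r) n′ M) (ℕₚ.∸-+-assoc n 1 α) (shortenMany α (shorten C))

  union : {L₁ L₂ : List (Vec F (suc k))} → Code L₁ M₁ → Code L₂ M₂ →
          ∃ λ T → M₁ ≤ T × T ≤ M₁ + M₂ × Code (L₁ ++ L₂) T
  union {M₁ = M₁} {M₂} {L₁} {L₂} C₁ C₂ = T , M₁≤T , T≤M₁+M₂ , record
    { nonZero = All-++⁺ (Code.nonZero C₁) (Code.nonZero C₂)
    ; spanning = λ u u≢0 → Any-++⁺ˡ (Code.spanning C₁ u u≢0)
    ; maxMeet = proj₂ (maxMeet-exists (L₁ ++ L₂))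
    }
    where
    open ℕₚ.≤-Reasoning
    T : ℕ
    T = proj₁ (maxMeet-exists (L₁ ++ L₂))
    open MaxMeet (proj₂ (maxMeet-exists (L₁ ++ L₂)))
    open MaxMeet (Code.maxMeet C₁) using ()
      renaming (hyperplane to u₁; hyperplane-nonZero to u₁≢0; meets-hyperplane to meets-u₁; meets≤ to meets≤M₁)
    M₁≤T : M₁ ≤ T
    M₁≤T = begin
      M₁                         ≡⟨ sym meets-u₁ ⟩
      meets u₁ L₁                ≤⟨ ℕₚ.m≤m+n _ _ ⟩
      meets u₁ L₁ + meets u₁ L₂  ≡⟨ sym (meets-++ u₁ L₁ L₂) ⟩
      meets u₁ (L₁ ++ L₂)        ≤⟨ meets≤ u₁ u₁≢0 ⟩
      T                          ∎
    T≤M₁+M₂ : T ≤ M₁ + M₂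
    T≤M₁+M₂ = begin
      T                                          ≡⟨ sym meets-hyperplane ⟩
      meets hyperplane (L₁ ++ L₂)                ≡⟨ meets-++ hyperplane L₁ L₂ ⟩
      meets hyperplane L₁ + meets hyperplane L₂  ≤⟨ +-mono-≤ (meets≤M₁ hyperplane hyperplane-nonZero)
                                                             (MaxMeet.meets≤ (Code.maxMeet C₂) hyperplane hyperplane-nonZero) ⟩
      M₁ + M₂                                    ∎

  union≥ : 1 ≤ M₁ → Code≥ (suc k) n₁ M₁ → Code≥ (suc k) n₂ M₂ → Code≥ (suc k) (n₁ + n₂) (M₁ + M₂)
  union≥ {M₁} {M₂ = M₂} 1≤M₁ (L₁ , n₁≤ , C₁) (L₂ , n₂≤ , C₂) with union C₁ C₂
  ... | T , M₁≤T , T≤M₁+M₂ , C = Code≥-weaken n₁+n₂≤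
    (subst (Code≥ _ _) (ℕₚ.m∸n+n≡m T≤M₁+M₂) (padMany (≤-trans 1≤M₁ M₁≤T) (L₁ ++ L₂ , ≤-refl , C) (M₁ + M₂ ∸ T)))
    where
    n₁+n₂≤ : _ ≤ M₁ + M₂ ∸ T + length (L₁ ++ L₂)
    n₁+n₂≤ = ≤-trans (+-mono-≤ n₁≤ n₂≤) (≤-trans (ℕₚ.≤-reflexive (sym (length-++ L₁))) (ℕₚ.m≤n+m _ _))

  unionMany : 1 ≤ M₁ → Code≥ (suc k) n₁ M₁ → Code≥ (suc k) n₂ M₂ → ∀ t → Code≥ (suc k) (t * n₁ + n₂) (t * M₁ + M₂)
  unionMany _ _ C₂ zero = C₂
  unionMany {M₁} {n₁ = n₁} 1≤M₁ C₁ C₂ (suc t) =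
    subst₂ (Code≥ _) (sym (ℕₚ.+-assoc n₁ (t * n₁) _)) (sym (ℕₚ.+-assoc M₁ (t * M₁) _)) (union≥ 1≤M₁ C₁ (unionMany 1≤M₁ C₁ C₂ t))

  dim1-extend : Code≥ 1 n M → Code≥ 1 (suc n) M
  dim1-extend {M = M} (L , n≤length , C) = u₀ ∷ L , s≤s n≤length , code-∷ u₀≢0 C (record
    { hyperplane = u₀
    ; hyperplane-nonZero = u₀≢0
    ; meets-hyperplane = trans (meets-u₀∷ u₀≢0) meets-hyperplane
    ; meets≤ = λ u u≢0 → subst (_≤ M) (sym (meets-u₀∷ u≢0)) (meets≤ u u≢0)
    })
    where
    open Code C
    open MaxMeet maxMeet renaming (hyperplane to u₀; hyperplane-nonZero to u₀≢0)
    meets-u₀∷ : {u : Vec F 1} → NonZero F u → meets u (u₀ ∷ L) ≡ meets u L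
    meets-u₀∷ {u} u≢0 = meets-∷-off u u₀ L (dim1-dot≢0 u≢0 u₀≢0)

  noAsMDS-dim0 : ¬ AsMDS F s n 0
  noAsMDS-dim0 (_ , _ , _ , (_ , _ , (() , _) , _) , _)

  noMaxLen-dim1 : ¬ IsMaxLen F s 1 m
  noMaxLen-dim1 {m = m} maxLen = ℕₚ.n≮n m (maxLen-≥ maxLen (dim1-extend (maxLen-code maxLen)))

  maxLen-<-suc-defect : IsMaxLen F s k m → IsMaxLen F (suc s) k m′ → m < m′
  maxLen-<-suc-defect {k = zero} maxLen _ = ⊥-elim (noAsMDS-dim0 (proj₁ maxLen))
  maxLen-<-suc-defect {k = suc zero} maxLen _ = ⊥-elim (noMaxLen-dim1 maxLen)
  maxLen-<-suc-defect {s} {suc (suc r)} maxLen maxLen′ =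
    maxLen-≥ maxLen′ (subst (Code≥ _ _) (sym (ℕₚ.+-suc (suc r) s)) (pad (s≤s z≤n) (maxLen-code maxLen)))

  maxLen-≤-shortened′ : ∀ α r → IsMaxLen F s (α + suc r) m → IsMaxLen F s (suc r) m′ → m ≤ m′ + α
  maxLen-≤-shortened′ α zero _ maxLen′ = ⊥-elim (noMaxLen-dim1 maxLen′)
  maxLen-≤-shortened′ {s} {m} {m′} α (suc r) maxLen maxLen′ =
    ≤-trans (ℕₚ.m≤n+m∸n m α) (subst (α + (m ∸ α) ≤_) (ℕₚ.+-comm α m′) (ℕₚ.+-monoʳ-≤ α m∸α≤m′))
    where
    dimension : ∀ α r → α + suc (suc r) ≡ 2 + (α + r)
    dimension = solve-∀
    defect : ∀ α r s → suc (α + r) + s ≡ α + (suc r + s)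
    defect = solve-∀
    m∸α≤m′ : m ∸ α ≤ m′
    m∸α≤m′ = maxLen-≥ maxLen′ (shortenMany α (subst (Code≥ _ m) (defect α r s)
               (maxLen-code (subst (λ k → IsMaxLen F s k m) (dimension α r) maxLen))))

  maxLen-≤-shortened : ∀ {α} → α < k → IsMaxLen F s k m → IsMaxLen F s (k ∸ α) m′ → m ≤ m′ + α
  maxLen-≤-shortened {k} {s} {m} {m′} {α} α<k maxLen maxLen′ with ℕₚ.m≤n⇒∃[o]m+o≡n α<k
  ... | r , refl = maxLen-≤-shortened′ α r
    (subst (λ k → IsMaxLen F s k m) (sym (ℕₚ.+-suc α r)) maxLen)
    (subst (λ k → IsMaxLen F s k m′) (trans (cong (_∸ α) (sym (ℕₚ.+-suc α r))) (ℕₚ.m+n∸m≡n α (suc r))) maxLen′)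

  maxLen-≤-plane : 3 ≤ k → IsMaxLen F s k m → IsMaxLen F s 3 m′ → m ≤ m′ + (k ∸ 3)
  maxLen-≤-plane {k} {s} {m} (s≤s (s≤s (s≤s {n = α} z≤n))) maxLen maxLen′ =
    maxLen-≤-shortened′ α 2 (subst (λ k → IsMaxLen F s k m) (ℕₚ.+-comm 3 α) maxLen) maxLen′

  maxLen-≥-union : 1 ≤ k → IsMaxLen F (k ∸ 1 + s₁ + s₂) k m → IsMaxLen F s₁ k m₁ → IsMaxLen F s₂ k m₂ → m₁ + m₂ ≤ m
  maxLen-≥-union {suc zero} _ _ maxLen₁ _ = ⊥-elim (noMaxLen-dim1 maxLen₁)
  maxLen-≥-union {suc (suc r)} {s₁} {s₂} _ maxLen maxLen₁ maxLen₂ =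
    maxLen-≥ maxLen (subst (Code≥ _ _) (defect (suc r) s₁ s₂) (union≥ (s≤s z≤n) (maxLen-code maxLen₁) (maxLen-code maxLen₂)))
    where
    defect : ∀ r s₁ s₂ → (r + s₁) + (r + s₂) ≡ r + (r + s₁ + s₂)
    defect = solve-∀

  maxLen-plane-even : IsMaxLen F (2 * t) 3 m → IsMaxLen F 0 3 m₀ → suc t * m₀ ≤ m
  maxLen-plane-even {t} {m} {m₀} maxLen maxLen₀ =
    subst (_≤ m) (ℕₚ.+-comm (t * m₀) m₀)
      (maxLen-≥ maxLen (subst (Code≥ 3 _) (defect t) (unionMany (s≤s z≤n) code₀ code₀ t)))
    where
    code₀ : Code≥ 3 m₀ 2
    code₀ = maxLen-code maxLen₀
    defect : ∀ t → t * 2 + 2 ≡ 2 + 2 * t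
    defect = solve-∀

  maxLen-plane-odd : IsMaxLen F (suc (2 * t)) 3 m → IsMaxLen F 0 3 m₀ → IsMaxLen F 1 3 m₁ → t * m₀ + m₁ ≤ m
  maxLen-plane-odd {t} maxLen maxLen₀ maxLen₁ =
    maxLen-≥ maxLen (subst (Code≥ 3 _) (defect t) (unionMany (s≤s z≤n) (maxLen-code maxLen₀) (maxLen-code maxLen₁) t))
    where
    defect : ∀ t → t * 2 + 3 ≡ 2 + suc (2 * t)
    defect = solve-∀

mainTheorem4 : ∀ {q : ℕ} (F : FiniteField q) →
    -- (1) m^s(k,q) < m^{s+1}(k,q)
    (∀ s k m m′ → IsMaxLen F s k m → IsMaxLen F (suc s) k m′ → m < m′) ×
    -- (2) k ≥ 2 : m^s(k,q) ≤ m^s(k-1,q) + 1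
    (∀ s k m m′ → 2 ≤ k → IsMaxLen F s k m → IsMaxLen F s (k ∸ 1) m′ → m ≤ m′ + 1) ×
    -- (3) α < k : m^s(k,q) ≤ m^s(k-α,q) + α
    (∀ s k α m m′ → α < k → IsMaxLen F s k m → IsMaxLen F s (k ∸ α) m′ → m ≤ m′ + α) ×
    -- (3') k ≥ 3 : m^s(k,q) ≤ m^s(3,q) + k - 3
    (∀ s k m m′ → 3 ≤ k → IsMaxLen F s k m → IsMaxLen F s 3 m′ → m ≤ m′ + (k ∸ 3)) ×
    -- (4) s = k-1+s1+s2 : m^s(k,q) ≥ m^{s1}(k,q) + m^{s2}(k,q)
    (∀ k s₁ s₂ m m₁ m₂ → 1 ≤ k → IsMaxLen F (k ∸ 1 + s₁ + s₂) k m →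
       IsMaxLen F s₁ k m₁ → IsMaxLen F s₂ k m₂ → m₁ + m₂ ≤ m) ×
    -- (5a) s = 2t even : m^s(3,q) ≥ ((s+2)/2) m(3,q) = (t+1) m(3,q)
    (∀ t m m₀ → IsMaxLen F (2 * t) 3 m → IsMaxLen F 0 3 m₀ → suc t * m₀ ≤ m) ×
    -- (5b) s = 2t+1 odd : m^s(3,q) ≥ ((s-1)/2) m(3,q) + m^1(3,q) = t m(3,q) + m^1(3,q)
    (∀ t m m₀ m₁ → IsMaxLen F (suc (2 * t)) 3 m → IsMaxLen F 0 3 m₀ →
       IsMaxLen F 1 3 m₁ → t * m₀ + m₁ ≤ m)
mainTheorem4 F =
  (λ _ _ _ _ → maxLen-<-suc-defect F) ,
  (λ _ _ _ _ → maxLen-≤-shortened F) ,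
  (λ _ _ _ _ _ → maxLen-≤-shortened F) ,
  (λ _ _ _ _ → maxLen-≤-plane F) ,
  (λ _ _ _ _ _ _ → maxLen-≥-union F) ,
  (λ t _ _ → maxLen-plane-even F {t = t}) ,
  (λ t _ _ _ → maxLen-plane-odd F {t = t})
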